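{- Let $n,m\ge 5$ be integers. Then $\mu_{\rm t}(K_n\times K_m)=\mu(K_n\times K_m)=nm-4$.
   Context: $K_n\times K_m$ is the direct product of complete graphs: vertex set $[n]\times[m]$, with $(i,j)$ adjacent to $(i',j')$ iff $i\ne i'$ and $j\ne j'$. For a connected graph $G$ and $X\subseteq V(G)$, two vertices $x,y$ are $X$-visible if there is a shortest $x,y$-path whose internal vertices are not in $X$. $X$ is a mutual-visibility set if every two vertices of $X$ are $X$-visible, and a total mutual-visibility set if every two vertices of $V(G)$ are $X$-visible. $\mu(G)$ and $\mu_{\rm t}(G)$ denote the maximum cardinality of a mutual-visibility set, respectively total mutual-visibility set, of $G$. -}

module Defs where

open import Data.Nat using (ℕ; zero; suc; _<_; _≤_)
open import Data.Fin using (Fin)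
open import Data.Product using (Σ; _×_; ∃; ∃-syntax; _,_)
open import Data.Unit using (⊤)
open import Data.List using (List; length)
open import Data.List.Membership.Propositional using (_∈_; _∉_)
open import Data.List.Relation.Unary.Unique.Propositional using (Unique)
open import Relation.Nullary using (¬_)
open import Relation.Binary.PropositionalEquality using (_≡_; _≢_)

module Graph {V : Set} (Adj : V → V → Set) where

  data Walk : V → V → ℕ → Set where
    []  : ∀ {x} → Walk x x 0
    _∷_ : ∀ {x y z k} → Adj x y → Walk y z k → Walk x z (suc k)

  -- A shortest x,y-path: a walk of length k such that no x,y-walk is shorter
  -- (k is then the distance d(x,y); such a walk is automatically a path).
  IsShortest : ∀ {x y k} → Walk x y k → Set
  IsShortest {x} {y} {k} _ = ∀ k′ → k′ < k → ¬ Walk x y k′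

  AvoidFrom : (X : List V) → ∀ {x y k} → Walk x y k → Set
  AvoidFrom X []                  = ⊤
  AvoidFrom X (_∷_ {x = x} e w)   = (x ∉ X) × AvoidFrom X w

  InternalAvoid : (X : List V) → ∀ {x y k} → Walk x y k → Set
  InternalAvoid X []      = ⊤
  InternalAvoid X (e ∷ w) = AvoidFrom X w

  Visible : List V → V → V → Set
  Visible X x y = ∃[ k ] Σ (Walk x y k) λ w → IsShortest w × InternalAvoid X w

  -- vertex sets are duplicate-free lists; cardinality is length
  IsMutualVisibility : List V → Set
  IsMutualVisibility X = Unique X × (∀ x y → x ∈ X → y ∈ X → Visible X x y)

  IsTotalMutualVisibility : List V → Set
  IsTotalMutualVisibility X = Unique X × (∀ x y → Visible X x y)

  IsMaxCard : (List V → Set) → ℕ → Set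
  IsMaxCard P k = (∃[ X ] (P X × length X ≡ k)) × (∀ X → P X → length X ≤ k)

  μ≡ : ℕ → Set
  μ≡ = IsMaxCard IsMutualVisibility

  μt≡ : ℕ → Set
  μt≡ = IsMaxCard IsTotalMutualVisibility

KAdj : (n m : ℕ) → Fin n × Fin m → Fin n × Fin m → Set
KAdj n m (i , j) (i′ , j′) = (i ≢ i′) × (j ≢ j′)

module Submission where

-- If the complement of a mutual-visibility set X had at most three vertices y₁, y₂, y₃, there
-- would be two vertices x, y ∉ {y₁, y₂, y₃} at distance 2 none of whose common neighbours is
-- a yᵢ; all those common neighbours lie in X, so x, y ∈ X are not X-visible. Such a pair exists:
-- if the yᵢ occupy at most two rows i₀, i₁, take (i₀, j), (i₁, j) for a column j they miss
-- (symmetrically for columns); otherwise the yᵢ = (aᵢ, bᵢ) have pairwise distinct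
-- columns and a₁ ∉ {a₂, a₃}, and (a₁, b₂), (a₁, b₃) works. Conversely, removing the four
-- diagonal vertices (d, d), d < 4, leaves a total mutual-visibility set: two vertices sharing
-- a row or a column involve at most three coordinates, so some (d, d) is a common neighbour.

open import Defs
open import Data.Nat using (ℕ; zero; suc; _≤_; _<_; _*_; _∸_; _+_; z≤n; s≤s; _≤?_)
open import Data.Nat.Properties
  using (≤-refl; ≤-antisym; <⇒≤; <⇒≱; ≰⇒>; m+n≤o⇒m≤o∸n; m+n∸m≡n; +-monoʳ-≤)
  renaming (_≟_ to _≟ℕ_)
open import Data.Product using (_×_; _,_; proj₁; proj₂; ∃; ∃-syntax; swap)
open import Data.Product.Properties using (≡-dec)
open import Data.Sum using (_⊎_; inj₁; inj₂; [_,_]′; map₂)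
open import Data.Empty using (⊥; ⊥-elim)
open import Data.Unit using (tt)
open import Data.Fin using (Fin; zero; toℕ; inject≤) renaming (_≟_ to _≟F_)
open import Data.Fin.Properties using (toℕ-inject≤; toℕ-injective; inject≤-injective)
open import Data.List using (List; []; _∷_; length; map; _++_; filter; allFin; cartesianProduct)
open import Data.List.Properties using (length-map; length-++; length-tabulate; length-removeAt′)
open import Data.List.Relation.Unary.Any using (here; there; index; _─_)
open import Data.List.Relation.Unary.All as All using (All; []; _∷_; all?)
open import Data.List.Relation.Unary.All.Properties using (¬All⇒Any¬) renaming (map⁺ to All-map⁺)
open import Data.List.Relation.Binary.Subset.Propositional using (_⊆_)
open import Data.List.Membership.Propositional using (_∈_; _∉_; find)
open import Data.List.Membership.Propositional.Properties
  using (∈-map⁺; ∈-++⁺ˡ; ∈-++⁺ʳ; ∈-filter⁺; ∈-filter⁻; ∈-allFin; ∈-cartesianProduct⁺)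
open import Data.List.Relation.Unary.Unique.Propositional using (Unique; _∷_)
open import Data.List.Relation.Unary.Unique.Propositional.Properties
  using (map⁺; ++⁺; filter⁺; cartesianProduct⁺; allFin⁺)
import Data.List.Membership.DecPropositional as DecMembership
open import Function using (_∘_)
open import Relation.Nullary using (¬_; Dec; yes; no; ¬?)
open import Relation.Binary.Definitions using (DecidableEquality)
open import Relation.Binary.PropositionalEquality using (_≡_; _≢_; ≢-sym; module ≡-Reasoning; refl; sym; trans; cong; cong₂; subst)

module _ {A : Set} where

  ∈-─ : ∀ {x y} {ys : List A} (y∈ys : y ∈ ys) → x ∈ ys → x ≢ y → x ∈ (ys ─ y∈ys)
  ∈-─ (here refl) (here refl) x≢y = ⊥-elim (x≢y refl)
  ∈-─ (here refl) (there x∈ys) _  = x∈ys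
  ∈-─ (there _)   (here refl) _   = here refl
  ∈-─ (there y∈ys) (there x∈ys) x≢y = there (∈-─ y∈ys x∈ys x≢y)

  Unique-⊆⇒length≤ : ∀ {xs ys : List A} → Unique xs → xs ⊆ ys → length xs ≤ length ys
  Unique-⊆⇒length≤ {[]}     _              _  = z≤n
  Unique-⊆⇒length≤ {x ∷ xs} {ys} (x∉xs ∷ xs!) xs⊆ys =
    subst (suc (length xs) ≤_) (sym (length-removeAt′ ys (index x∈ys)))
      (s≤s (Unique-⊆⇒length≤ xs! λ z∈xs →
        ∈-─ x∈ys (xs⊆ys (there z∈xs)) λ z≡x → All.lookup x∉xs z∈xs (sym z≡x)))
    where
    x∈ys : x ∈ ys
    x∈ys = xs⊆ys (here refl)

  ⊆-triple : A → (ys : List A) → length ys < 4 → ∃[ a ] ∃[ b ] ∃[ c ] ys ⊆ a ∷ b ∷ c ∷ []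
  ⊆-triple a []          _ = a , a , a , λ ()
  ⊆-triple _ (a ∷ [])    _ = a , a , a , λ { (here e) → here e }
  ⊆-triple _ (a ∷ b ∷ []) _ = a , b , b , λ { (here e) → here e ; (there (here e)) → there (here e) }
  ⊆-triple _ (a ∷ b ∷ c ∷ []) _ = a , b , c , λ p → p
  ⊆-triple _ (_ ∷ _ ∷ _ ∷ _ ∷ _) (s≤s (s≤s (s≤s (s≤s ()))))

length-cartesianProduct : ∀ {A B : Set} (xs : List A) (ys : List B) →
                          length (cartesianProduct xs ys) ≡ length xs * length ys
length-cartesianProduct []       ys = refl
length-cartesianProduct (x ∷ xs) ys =
  trans (length-++ (map (x ,_) ys)) (cong₂ _+_ (length-map (x ,_) ys) (length-cartesianProduct xs ys))

length-allFin : ∀ k → length (allFin k) ≡ k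
length-allFin k = length-tabulate (λ i → i)

open DecMembership _≟ℕ_ using () renaming (_∈?_ to _∈ℕ?_)

∃-toℕ∉ : ∀ {k} (l : List ℕ) → length l < k → ∃ λ (d : Fin k) → toℕ d ∉ l
∃-toℕ∉ {k} l |l|<k with all? (λ d → toℕ d ∈ℕ? l) (allFin k)
... | no ¬all =
  let d , _ , toℕd∉l = find (¬All⇒Any¬ (λ d → toℕ d ∈ℕ? l) (allFin k) ¬all) in d , toℕd∉l
... | yes all = ⊥-elim (<⇒≱ |l|<k k≤|l|)
  where
  k≤|l| : k ≤ length l
  k≤|l| = subst (_≤ length l) (trans (length-map toℕ (allFin k)) (length-allFin k))
            (Unique-⊆⇒length≤ (map⁺ toℕ-injective (allFin⁺ k)) (All.lookup (All-map⁺ all)))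

∃-∉ : ∀ {k} (l : List (Fin k)) → length l < k → ∃ λ d → d ∉ l
∃-∉ l |l|<k =
  let d , toℕd∉ = ∃-toℕ∉ (map toℕ l) (subst (_< _) (sym (length-map toℕ l)) |l|<k)
  in d , λ d∈l → toℕd∉ (∈-map⁺ toℕ d∈l)

module Complement {A : Set} (_≟_ : DecidableEquality A)
                  {univ : List A} (univ! : Unique univ) (∈-univ : ∀ x → x ∈ univ) where

  open DecMembership _≟_ using (_∈?_)

  _∉?_ : ∀ z X → Dec (z ∉ X)
  z ∉? X = ¬? (z ∈? X)

  _ᶜ : List A → List A
  X ᶜ = filter (_∉? X) univ

  ∈⇒∉ᶜ : ∀ {X z} → z ∈ X → z ∉ X ᶜ
  ∈⇒∉ᶜ {X} z∈X z∈Xᶜ = proj₂ (∈-filter⁻ (_∉? X) {xs = univ} z∈Xᶜ) z∈X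

  ∈⊎∈ᶜ : ∀ X z → z ∈ X ⊎ z ∈ X ᶜ
  ∈⊎∈ᶜ X z with z ∈? X
  ... | yes z∈X = inj₁ z∈X
  ... | no  z∉X = inj₂ (∈-filter⁺ (_∉? X) (∈-univ z) z∉X)

  length-+-ᶜ : ∀ {X} → Unique X → length X + length (X ᶜ) ≡ length univ
  length-+-ᶜ {X} X! = begin
    length X + length (X ᶜ)  ≡⟨ length-++ X ⟨
    length (X ++ X ᶜ)        ≡⟨ ≤-antisym (Unique-⊆⇒length≤ X++Xᶜ! λ {z} _ → ∈-univ z)
                                          (Unique-⊆⇒length≤ univ! univ⊆X++Xᶜ) ⟩
    length univ              ∎
    where
    open ≡-Reasoning
    X++Xᶜ! : Unique (X ++ X ᶜ)
    X++Xᶜ! = ++⁺ X! (filter⁺ (_∉? X) univ!) λ (z∈X , z∈Xᶜ) → ∈⇒∉ᶜ z∈X z∈Xᶜ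
    univ⊆X++Xᶜ : univ ⊆ X ++ X ᶜ
    univ⊆X++Xᶜ {z} _ = [ ∈-++⁺ˡ , ∈-++⁺ʳ X ]′ (∈⊎∈ᶜ X z)

module Visibility {V : Set} (Adj : V → V → Set) where

  open Graph Adj

  walk₀⇒≡ : ∀ {x y} → Walk x y 0 → x ≡ y
  walk₀⇒≡ [] = refl

  visible-refl : ∀ {X} x → Visible X x x
  visible-refl x = 0 , [] , (λ _ ()) , tt

  visible-adjacent : ∀ {X x y} → x ≢ y → Adj x y → Visible X x y
  visible-adjacent x≢y x~y = 1 , x~y ∷ [] , shortest , tt
    where
    shortest : IsShortest (x~y ∷ [])
    shortest zero _ w = x≢y (walk₀⇒≡ w)
    shortest (suc _) (s≤s ()) _

  visible-via : ∀ {X x y c} → x ≢ y → ¬ Adj x y → Adj x c → Adj c y → c ∉ X → Visible X x y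
  visible-via x≢y x≁y x~c c~y c∉X = 2 , x~c ∷ c~y ∷ [] , shortest , c∉X , tt
    where
    shortest : IsShortest (x~c ∷ c~y ∷ [])
    shortest zero        _ w        = x≢y (walk₀⇒≡ w)
    shortest (suc zero)  _ (e ∷ []) = x≁y e
    shortest (suc (suc _)) (s≤s (s≤s ())) _

  record BlockedPair (Y : List V) : Set where
    field
      x y c  : V
      x≢y    : x ≢ y
      x≁y    : ¬ Adj x y
      x~c    : Adj x c
      c~y    : Adj c y
      x∉Y    : x ∉ Y
      y∉Y    : y ∉ Y
      blocks : ∀ {z} → z ∈ Y → Adj x z → Adj z y → ⊥

  blocked⇒¬mutual : ∀ {X Y} → (∀ z → z ∈ X ⊎ z ∈ Y) → BlockedPair Y → ¬ IsMutualVisibility X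
  blocked⇒¬mutual {X} {Y} cover pair (_ , visible) = invisible (visible x y (∈X x∉Y) (∈X y∉Y))
    where
    open BlockedPair pair
    ∈X : ∀ {z} → z ∉ Y → z ∈ X
    ∈X {z} z∉Y = [ (λ z∈X → z∈X) , (λ z∈Y → ⊥-elim (z∉Y z∈Y)) ]′ (cover z)
    outside-X : ∀ {z} → z ∉ X → z ∈ Y
    outside-X {z} z∉X = [ (λ z∈X → ⊥-elim (z∉X z∈X)) , (λ z∈Y → z∈Y) ]′ (cover z)
    invisible : ¬ Visible X x y
    invisible (zero , w , _) = x≢y (walk₀⇒≡ w)
    invisible (suc zero , e ∷ [] , _) = x≁y e
    invisible (suc (suc zero) , x~z ∷ z~y ∷ [] , _ , z∉X , _) = blocks (outside-X z∉X) x~z z~y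
    invisible (suc (suc (suc _)) , _ , shortest , _) = shortest 2 (s≤s (s≤s (s≤s z≤n))) (x~c ∷ c~y ∷ [])

  total⇒mutual : ∀ {X} → IsTotalMutualVisibility X → IsMutualVisibility X
  total⇒mutual (X! , visible) = X! , λ x y _ _ → visible x y

  μt≡×μ≡ : ∀ {X k} → IsTotalMutualVisibility X → length X ≡ k →
           (∀ Y → IsMutualVisibility Y → length Y ≤ k) → μt≡ k × μ≡ k
  μt≡×μ≡ {X} total |X|≡k bound =
    ((X , total , |X|≡k) , λ Y total-Y → bound Y (total⇒mutual total-Y)) ,
    ((X , total⇒mutual total , |X|≡k) , bound)

open Visibility using (BlockedPair)

KAdj-sym : ∀ {n m} {x y : Fin n × Fin m} → KAdj n m x y → KAdj n m y x
KAdj-sym (i≢i′ , j≢j′) = ≢-sym i≢i′ , ≢-sym j≢j′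

⊆-distinct-pair : ∀ {k} → 2 ≤ k → (i i′ : Fin k) →
                  ∃[ i₀ ] ∃[ i₁ ] i₀ ≢ i₁ × i ∷ i′ ∷ [] ⊆ i₀ ∷ i₁ ∷ []
⊆-distinct-pair 2≤k i i′ with i ≟F i′
... | no i≢i′ = i , i′ , i≢i′ , λ p → p
... | yes refl =
  let j , j∉ = ∃-∉ (i ∷ []) 2≤k
  in i , j , (λ i≡j → j∉ (here (sym i≡j))) , λ { (here e) → here e ; (there (here e)) → here e }

transpose-blocked : ∀ {n m} {Y : List (Fin n × Fin m)} →
                    BlockedPair (KAdj m n) (map swap Y) → BlockedPair (KAdj n m) Y
transpose-blocked pair = record
  { x = swap x ; y = swap y ; c = swap c
  ; x≢y = λ e → x≢y (cong swap e)
  ; x≁y = λ e → x≁y (swap e)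
  ; x~c = swap x~c
  ; c~y = swap c~y
  ; x∉Y = λ x∈Y → x∉Y (∈-map⁺ swap x∈Y)
  ; y∉Y = λ y∈Y → y∉Y (∈-map⁺ swap y∈Y)
  ; blocks = λ z∈Y x~z z~y → blocks (∈-map⁺ swap z∈Y) (swap x~z) (swap z~y)
  }
  where open BlockedPair pair

rows-blocked : ∀ {n m} → 3 ≤ n → 2 ≤ m → (Y : List (Fin n × Fin m)) → length Y < m →
               ∀ i i′ → All (λ y → proj₁ y ∈ i ∷ i′ ∷ []) Y → BlockedPair (KAdj n m) Y
rows-blocked {n} {m} 3≤n 2≤m Y |Y|<m i i′ rows
  with ⊆-distinct-pair (<⇒≤ 3≤n) i i′
     | ∃-∉ (map proj₂ Y) (subst (_< m) (sym (length-map proj₂ Y)) |Y|<m)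
... | i₀ , i₁ , i₀≢i₁ , ⊆i₀i₁ | j , j∉Y
  with ∃-∉ (i₀ ∷ i₁ ∷ []) 3≤n | ∃-∉ (j ∷ []) 2≤m
... | k , k∉ | j′ , j′∉ = record
  { x = i₀ , j ; y = i₁ , j ; c = k , j′
  ; x≢y = λ e → i₀≢i₁ (cong proj₁ e)
  ; x≁y = λ (_ , j≢j) → j≢j refl
  ; x~c = (λ i₀≡k → k∉ (here (sym i₀≡k))) , (λ j≡j′ → j′∉ (here (sym j≡j′)))
  ; c~y = (λ k≡i₁ → k∉ (there (here k≡i₁))) , (λ j′≡j → j′∉ (here j′≡j))
  ; x∉Y = column-j-misses-Y
  ; y∉Y = column-j-misses-Y
  ; blocks = blocks
  }
  where
  column-j-misses-Y : ∀ {r} → (r , j) ∉ Y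
  column-j-misses-Y rj∈Y = j∉Y (∈-map⁺ proj₂ rj∈Y)
  blocks : ∀ {z} → z ∈ Y → KAdj n m (i₀ , j) z → KAdj n m z (i₁ , j) → ⊥
  blocks z∈Y (i₀≢ , _) (≢i₁ , _) with ⊆i₀i₁ (All.lookup rows z∈Y)
  ... | here z₁≡i₀         = i₀≢ (sym z₁≡i₀)
  ... | there (here z₁≡i₁) = ≢i₁ z₁≡i₁

columns-blocked : ∀ {n m} → 3 ≤ m → 2 ≤ n → (Y : List (Fin n × Fin m)) → length Y < n →
                  ∀ j j′ → All (λ y → proj₂ y ∈ j ∷ j′ ∷ []) Y → BlockedPair (KAdj n m) Y
columns-blocked {n} 3≤m 2≤n Y |Y|<n j j′ columns =
  transpose-blocked (rows-blocked 3≤m 2≤n (map swap Y)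
    (subst (_< n) (sym (length-map swap Y)) |Y|<n) j j′ (All-map⁺ columns))

scattered-blocked : ∀ {n m} {a₁ a₂ a₃ : Fin n} {b₁ b₂ b₃ : Fin m} →
                    a₁ ≢ a₂ → a₁ ≢ a₃ → b₁ ≢ b₂ → b₁ ≢ b₃ → b₂ ≢ b₃ →
                    BlockedPair (KAdj n m) ((a₁ , b₁) ∷ (a₂ , b₂) ∷ (a₃ , b₃) ∷ [])
scattered-blocked {a₁ = a₁} {a₂} {b₁ = b₁} {b₂} {b₃} a₁≢a₂ a₁≢a₃ b₁≢b₂ b₁≢b₃ b₂≢b₃ = record
  { x = a₁ , b₂ ; y = a₁ , b₃ ; c = a₂ , b₁
  ; x≢y = λ e → b₂≢b₃ (cong proj₂ e)
  ; x≁y = λ (a₁≢a₁ , _) → a₁≢a₁ refl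
  ; x~c = a₁≢a₂ , ≢-sym b₁≢b₂
  ; c~y = ≢-sym a₁≢a₂ , b₁≢b₃
  ; x∉Y = λ { (here e)                 → b₁≢b₂ (sym (cong proj₂ e))
            ; (there (here e))         → a₁≢a₂ (cong proj₁ e)
            ; (there (there (here e))) → b₂≢b₃ (cong proj₂ e) }
  ; y∉Y = λ { (here e)                 → b₁≢b₃ (sym (cong proj₂ e))
            ; (there (here e))         → a₁≢a₂ (cong proj₁ e)
            ; (there (there (here e))) → a₁≢a₃ (cong proj₁ e) }
  ; blocks = λ { (here refl)                 (a₁≢a₁ , _) _           → a₁≢a₁ refl
               ; (there (here refl))         (_ , b₂≢b₂) _           → b₂≢b₂ refl
               ; (there (there (here refl))) _           (_ , b₃≢b₃) → b₃≢b₃ refl }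
  }

module _ {n m : ℕ} (4≤n : 4 ≤ n) (4≤m : 4 ≤ m) where

  open Graph (KAdj n m)
  open Visibility (KAdj n m) hiding (BlockedPair)

  3≤n : 3 ≤ n
  3≤n = <⇒≤ 4≤n

  3≤m : 3 ≤ m
  3≤m = <⇒≤ 4≤m

  blocked-triple : ∀ y₁ y₂ y₃ → BlockedPair (KAdj n m) (y₁ ∷ y₂ ∷ y₃ ∷ [])
  blocked-triple (a₁ , b₁) (a₂ , b₂) (a₃ , b₃)
    with b₁ ≟F b₂ | b₁ ≟F b₃ | b₂ ≟F b₃ | a₁ ≟F a₂ | a₁ ≟F a₃
  ... | yes refl | _ | _ | _ | _ =
    columns-blocked 3≤m (<⇒≤ 3≤n) _ 4≤n b₁ b₃ (here refl ∷ here refl ∷ there (here refl) ∷ [])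
  ... | no _ | yes refl | _ | _ | _ =
    columns-blocked 3≤m (<⇒≤ 3≤n) _ 4≤n b₁ b₂ (here refl ∷ there (here refl) ∷ here refl ∷ [])
  ... | no _ | no _ | yes refl | _ | _ =
    columns-blocked 3≤m (<⇒≤ 3≤n) _ 4≤n b₁ b₂ (here refl ∷ there (here refl) ∷ there (here refl) ∷ [])
  ... | no _ | no _ | no _ | yes refl | _ =
    rows-blocked 3≤n (<⇒≤ 3≤m) _ 4≤m a₁ a₃ (here refl ∷ here refl ∷ there (here refl) ∷ [])
  ... | no _ | no _ | no _ | no _ | yes refl =
    rows-blocked 3≤n (<⇒≤ 3≤m) _ 4≤m a₁ a₂ (here refl ∷ there (here refl) ∷ here refl ∷ [])
  ... | no b₁≢b₂ | no b₁≢b₃ | no b₂≢b₃ | no a₁≢a₂ | no a₁≢a₃ =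
    scattered-blocked a₁≢a₂ a₁≢a₃ b₁≢b₂ b₁≢b₃ b₂≢b₃

  open Complement (≡-dec _≟F_ _≟F_) (cartesianProduct⁺ (allFin⁺ n) (allFin⁺ m))
                  (λ (i , j) → ∈-cartesianProduct⁺ (∈-allFin i) (∈-allFin j))

  length-+-ᶜ≡n*m : ∀ {X} → Unique X → length X + length (X ᶜ) ≡ n * m
  length-+-ᶜ≡n*m {X} X! = begin
    length X + length (X ᶜ)                           ≡⟨ length-+-ᶜ X! ⟩
    length (cartesianProduct (allFin n) (allFin m))   ≡⟨ length-cartesianProduct (allFin n) (allFin m) ⟩
    length (allFin n) * length (allFin m)             ≡⟨ cong₂ _*_ (length-allFin n) (length-allFin m) ⟩
    n * m                                             ∎
    where open ≡-Reasoning

  diag : Fin 4 → Fin n × Fin m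
  diag d = inject≤ d 4≤n , inject≤ d 4≤m

  diagonal : List (Fin n × Fin m)
  diagonal = map diag (allFin 4)

  4≤length-ᶜ : ∀ {X} → IsMutualVisibility X → 4 ≤ length (X ᶜ)
  4≤length-ᶜ {X} isMV with 4 ≤? length (X ᶜ)
  ... | yes 4≤ = 4≤
  ... | no 4≰ =
    let y₁ , y₂ , y₃ , Xᶜ⊆ = ⊆-triple (diag zero) (X ᶜ) (≰⇒> 4≰)
    in ⊥-elim (blocked⇒¬mutual (λ z → map₂ Xᶜ⊆ (∈⊎∈ᶜ X z)) (blocked-triple y₁ y₂ y₃) isMV)

  mutual-visibility-bound : ∀ X → IsMutualVisibility X → length X ≤ n * m ∸ 4
  mutual-visibility-bound X isMV = m+n≤o⇒m≤o∸n (length X)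
    (subst (length X + 4 ≤_) (length-+-ᶜ≡n*m (proj₁ isMV)) (+-monoʳ-≤ (length X) (4≤length-ᶜ isMV)))

  length-diagonalᶜ : length (diagonal ᶜ) ≡ n * m ∸ 4
  length-diagonalᶜ = begin
    length (diagonal ᶜ)                        ≡⟨ sym (m+n∸m≡n 4 _) ⟩
    length diagonal + length (diagonal ᶜ) ∸ 4  ≡⟨ cong (_∸ 4) (length-+-ᶜ≡n*m diagonal!) ⟩
    n * m ∸ 4                                  ∎
    where
    open ≡-Reasoning
    diagonal! : Unique diagonal
    diagonal! = map⁺ {f = diag} (λ e → inject≤-injective 4≤n 4≤n _ _ (cong proj₁ e)) (allFin⁺ 4)

  diag-adjacent : ∀ {d i j} → toℕ d ≢ toℕ i → toℕ d ≢ toℕ j → KAdj n m (diag d) (i , j)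
  diag-adjacent {d} d≢i d≢j =
    (λ e → d≢i (trans (sym (toℕ-inject≤ d 4≤n)) (cong toℕ e))) ,
    (λ e → d≢j (trans (sym (toℕ-inject≤ d 4≤m)) (cong toℕ e)))

  visible-via-diagonal : ∀ {x y} d → x ≢ y → ¬ KAdj n m x y →
                         KAdj n m (diag d) x → KAdj n m (diag d) y → Visible (diagonal ᶜ) x y
  visible-via-diagonal d x≢y x≁y d~x d~y =
    visible-via x≢y x≁y (KAdj-sym d~x) d~y (∈⇒∉ᶜ (∈-map⁺ diag (∈-allFin d)))

  diagonalᶜ-total : IsTotalMutualVisibility (diagonal ᶜ)
  diagonalᶜ-total = filter⁺ _ (cartesianProduct⁺ (allFin⁺ n) (allFin⁺ m)) , visible
    where
    visible : ∀ x y → Visible (diagonal ᶜ) x y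
    visible (i , j) (i′ , j′) with i ≟F i′ | j ≟F j′
    ... | yes refl | yes refl = visible-refl _
    ... | no i≢i′  | no j≢j′  = visible-adjacent (λ e → i≢i′ (cong proj₁ e)) (i≢i′ , j≢j′)
    ... | yes refl | no j≢j′  =
      let d , d∉ = ∃-toℕ∉ (toℕ i ∷ toℕ j ∷ toℕ j′ ∷ []) ≤-refl
      in visible-via-diagonal d (λ e → j≢j′ (cong proj₂ e)) (λ (i≢i , _) → i≢i refl)
           (diag-adjacent (d∉ ∘ here) (d∉ ∘ there ∘ here))
           (diag-adjacent (d∉ ∘ here) (d∉ ∘ there ∘ there ∘ here))
    ... | no i≢i′  | yes refl =
      let d , d∉ = ∃-toℕ∉ (toℕ j ∷ toℕ i ∷ toℕ i′ ∷ []) ≤-refl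
      in visible-via-diagonal d (λ e → i≢i′ (cong proj₁ e)) (λ (_ , j≢j) → j≢j refl)
           (diag-adjacent (d∉ ∘ there ∘ here) (d∉ ∘ here))
           (diag-adjacent (d∉ ∘ there ∘ there ∘ here) (d∉ ∘ here))

theorem2p2 : (n m : ℕ) → 5 ≤ n → 5 ≤ m →
    Graph.μt≡ (KAdj n m) (n * m ∸ 4) × Graph.μ≡ (KAdj n m) (n * m ∸ 4)
theorem2p2 n m 5≤n 5≤m =
  Visibility.μt≡×μ≡ (KAdj n m) (diagonalᶜ-total 4≤n 4≤m) (length-diagonalᶜ 4≤n 4≤m)
    (mutual-visibility-bound 4≤n 4≤m)
  where
  4≤n : 4 ≤ n
  4≤n = <⇒≤ 5≤n
  4≤m : 4 ≤ m
  4≤m = <⇒≤ 5≤m
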